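{- Up to $\mathbf{S5[Con,Ground]}$-provable equivalence, there are exactly $1024$ formulas of $\mathcal{L}_\Box$ whose only variable is $x$.
   Context: $\mathcal{L}_\Box$ is the modal language with a countably infinite set of variables, two one-place predicate symbols $T,F$, and formulas $\varphi::=T(x)\mid F(x)\mid\neg\varphi\mid(\varphi\wedge\varphi)\mid\Box\varphi$; $\vee,\to,\leftrightarrow,\lozenge$ are abbreviations and $N(y)$ abbreviates $\neg T(y)\wedge\neg F(y)$. $\mathbf{S5}$ in this signature is the least set of formulas containing all substitution instances of classical propositional tautologies and all instances of $\Box(A\to B)\to(\Box A\to\Box B)$, $\Box A\to A$, $\lozenge A\to\Box\lozenge A$, closed under modus ponens and necessitation. $\mathbf{S5[Con,Ground]}$ additionally has, for every variable $y$, the axioms $\neg(T(y)\wedge F(y))$ and $(\lozenge T(y)\wedge\lozenge F(y))\to\lozenge N(y)$, closed under the same rules. Two formulas are equivalent if $\mathbf{S5[Con,Ground]}\vdash\varphi\leftrightarrow\psi$. -}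

module Defs where

open import Data.Nat using (ℕ)
open import Data.Bool using (Bool; true; false; not; _∧_)
open import Data.Fin using (Fin)
open import Data.Product using (Σ; _×_)
open import Relation.Binary.PropositionalEquality using (_≡_)
open import Relation.Nullary using (¬_)

Var : Set
Var = ℕ

data Fm : Set where
  T   : Var → Fm
  F   : Var → Fm
  ~_  : Fm → Fm
  _∧ᵐ_ : Fm → Fm → Fm
  □_  : Fm → Fm

infix  9 ~_ □_ ◇_
infixr 8 _∧ᵐ_
infixr 7 _∨ᵐ_
infixr 6 _⇒_
infix  5 _⇔ᵐ_

_∨ᵐ_ : Fm → Fm → Fm
A ∨ᵐ B = ~ (~ A ∧ᵐ ~ B)

_⇒_ : Fm → Fm → Fm
A ⇒ B = ~ (A ∧ᵐ ~ B)

_⇔ᵐ_ : Fm → Fm → Fm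
A ⇔ᵐ B = (A ⇒ B) ∧ᵐ (B ⇒ A)

◇_ : Fm → Fm
◇ A = ~ (□ (~ A))

N : Var → Fm
N y = ~ T y ∧ᵐ ~ F y

-- Classical propositional formulas (atoms indexed by ℕ), used to define
-- substitution instances of tautologies.
data PFm : Set where
  atom : ℕ → PFm
  pnot : PFm → PFm
  pand : PFm → PFm → PFm

evalP : (ℕ → Bool) → PFm → Bool
evalP v (atom n)   = v n
evalP v (pnot p)   = not (evalP v p)
evalP v (pand p q) = evalP v p ∧ evalP v q

Tautology : PFm → Set
Tautology p = (v : ℕ → Bool) → evalP v p ≡ true

subst : (ℕ → Fm) → PFm → Fm
subst σ (atom n)   = σ n
subst σ (pnot p)   = ~ subst σ p
subst σ (pand p q) = subst σ p ∧ᵐ subst σ q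

data ⊢_ : Fm → Set where
  taut  : (p : PFm) → Tautology p → (σ : ℕ → Fm) → ⊢ subst σ p
  ax-K  : (A B : Fm) → ⊢ (□ (A ⇒ B) ⇒ (□ A ⇒ □ B))
  ax-T  : (A : Fm) → ⊢ (□ A ⇒ A)
  ax-5  : (A : Fm) → ⊢ (◇ A ⇒ □ (◇ A))
  con   : (y : Var) → ⊢ (~ (T y ∧ᵐ F y))
  ground : (y : Var) → ⊢ ((◇ T y ∧ᵐ ◇ F y) ⇒ ◇ N y)
  mp    : {A B : Fm} → ⊢ (A ⇒ B) → ⊢ A → ⊢ B
  nec   : {A : Fm} → ⊢ A → ⊢ (□ A)

infix 3 ⊢_

_≈_ : Fm → Fm → Set
φ ≈ ψ = ⊢ (φ ⇔ᵐ ψ)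

x : Var
x = 0

OnlyVar : Var → Fm → Set
OnlyVar y (T z)     = z ≡ y
OnlyVar y (F z)     = z ≡ y
OnlyVar y (~ A)     = OnlyVar y A
OnlyVar y (A ∧ᵐ B)  = OnlyVar y A × OnlyVar y B
OnlyVar y (□ A)     = OnlyVar y A

-- The set of one-variable formulas, modulo ≈, has exactly n elements:
-- there are n representatives, each a formula in x alone, pairwise
-- non-equivalent, and every formula in x alone is equivalent to one of them.
ExactlyNClasses : ℕ → Set
ExactlyNClasses n =
  Σ (Fin n → Fm) λ r →
    ((i : Fin n) → OnlyVar x (r i)) ×
    ((i j : Fin n) → r i ≈ r j → i ≡ j) ×
    ((φ : Fm) → OnlyVar x φ → Σ (Fin n) λ i → φ ≈ r i)

module Submission where

-- A formula in x is evaluated at a world of an S5 model from the value of x there (true, false or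
-- neither; Con forbids both) and the set of values x takes in the model. By Ground that set is one
-- of six clusters, which gives ten points. Each point has a characteristic formula χ stating its
-- value and, for every value, whether it is possible; by induction on φ, χ proves φ or ¬φ
-- according to the truth of φ at the point, the □-case using that the cluster part of χ is
-- necessary. The logic proves that some χ holds, so every φ is equivalent to the disjunction of the
-- χ of the points at which it is true; by soundness, different sets of points give inequivalent
-- disjunctions, so the classes are counted by the 2^10 subsets of the ten points.

open import Data.Bool using (Bool; true; false; not; _∧_) renaming (T to IsTrue)
import Data.Bool as Bool
open import Data.Bool.Properties
  using (∧-conicalˡ; ∧-conicalʳ; ∧-zeroʳ; not-involutive; ¬-not; T-≡)
open import Data.Empty using (⊥-elim)
open import Data.Fin using (Fin; zero; suc; combine; funToFin; finToFun)
open import Data.Fin.Patterns using (0F; 1F; 2F; 3F; 4F; 5F; 6F; 7F; 8F; 9F)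
open import Data.Fin.Properties
  using (all?; _≟_; 2↔Bool; funToFin-finToFin; finToFun-funToFin)
open import Data.List using (List; []; _∷_)
open import Data.Nat using (ℕ; zero; suc; _<_; _⊔_; _^_; s<s; z<s)
open import Data.Nat.Properties using (≤-refl; m<n⇒m<n⊔o; m<n⇒m<o⊔n)
open import Data.Product using (∃; _,_)
open import Data.Vec.Functional using (foldr)
open import Function using (_∘_; case_of_; Equivalence; Inverse)
open import Relation.Binary.PropositionalEquality
  using (_≡_; _≢_; _≗_; refl; sym; trans; cong; cong₂; module ≡-Reasoning)
  renaming (subst to ≡-subst)
open import Relation.Nullary.Decidable using (toWitness; _→-dec_)

open import Defs

-- Deciding tautologies

bound : PFm → ℕ
bound (atom n)   = suc n
bound (pnot p)   = bound p
bound (pand p q) = bound p ⊔ bound q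

evalP-cong : ∀ {v w} p → (∀ {n} → n < bound p → v n ≡ w n) → evalP v p ≡ evalP w p
evalP-cong (atom n)   v≗w = v≗w (s<s ≤-refl)
evalP-cong (pnot p)   v≗w = cong not (evalP-cong p v≗w)
evalP-cong (pand p q) v≗w = cong₂ _∧_ (evalP-cong p (v≗w ∘ m<n⇒m<n⊔o (bound q)))
                                      (evalP-cong q (v≗w ∘ m<n⇒m<o⊔n (bound p)))

_∷ₐ_ : Bool → (ℕ → Bool) → ℕ → Bool
(b ∷ₐ ρ) zero    = b
(b ∷ₐ ρ) (suc n) = ρ n

truncate : ℕ → (ℕ → Bool) → ℕ → Bool
truncate zero    ρ = λ _ → false
truncate (suc k) ρ = ρ 0 ∷ₐ truncate k (ρ ∘ suc)

truncate-agrees : ∀ {k} ρ {n} → n < k → truncate k ρ n ≡ ρ n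
truncate-agrees ρ {zero}  z<s       = refl
truncate-agrees ρ {suc n} (s<s n<k) = truncate-agrees (ρ ∘ suc) n<k

everyAssignment : ℕ → ((ℕ → Bool) → Bool) → Bool
everyAssignment zero    f = f (λ _ → false)
everyAssignment (suc k) f =
  everyAssignment k (f ∘ (true ∷ₐ_)) ∧ everyAssignment k (f ∘ (false ∷ₐ_))

everyAssignment-sound : ∀ k f → everyAssignment k f ≡ true → ∀ ρ → f (truncate k ρ) ≡ true
everyAssignment-sound zero    f h ρ = h
everyAssignment-sound (suc k) f h ρ with ρ 0
... | true  = everyAssignment-sound k _ (∧-conicalˡ _ _ h) (ρ ∘ suc)
... | false = everyAssignment-sound k _ (∧-conicalʳ _ _ h) (ρ ∘ suc)

isTautology : PFm → Bool
isTautology p = everyAssignment (bound p) (λ ρ → evalP ρ p)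

isTautology-sound : ∀ p → isTautology p ≡ true → Tautology p
isTautology-sound p h ρ = trans (evalP-cong p (sym ∘ truncate-agrees ρ))
                                (everyAssignment-sound (bound p) (λ ρ → evalP ρ p) h ρ)

⊥ᵐ : Fm
⊥ᵐ = T x ∧ᵐ ~ T x

infixr 8 _∧ₚ_
infixr 7 _∨ₚ_
infixr 6 _⊃_

¬ₚ_ : PFm → PFm
¬ₚ_ = pnot

_∧ₚ_ _∨ₚ_ _⊃_ : PFm → PFm → PFm
_∧ₚ_ = pand
p ∨ₚ q = ¬ₚ (¬ₚ p ∧ₚ ¬ₚ q)
p ⊃ q = ¬ₚ (p ∧ₚ ¬ₚ q)

P Q R U : PFm
P = atom 0
Q = atom 1
R = atom 2
U = atom 3

at : List Fm → ℕ → Fm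
at []       _       = ⊥ᵐ
at (A ∷ _)  zero    = A
at (_ ∷ As) (suc n) = at As n

taut! : (p : PFm) {_ : IsTrue (isTautology p)} (As : List Fm) → ⊢ subst (at As) p
taut! p {h} As = taut p (isTautology-sound p (Equivalence.to T-≡ h)) (at As)

mp₂ : ∀ {A B C} → ⊢ A ⇒ B ⇒ C → ⊢ A → ⊢ B → ⊢ C
mp₂ d a b = mp (mp d a) b

⇒-refl : ∀ A → ⊢ A ⇒ A
⇒-refl A = taut! (P ⊃ P) (A ∷ [])

⇒-trans : ∀ {A B C} → ⊢ A ⇒ B → ⊢ B ⇒ C → ⊢ A ⇒ C
⇒-trans {A} {B} {C} = mp₂ (taut! ((P ⊃ Q) ⊃ (Q ⊃ R) ⊃ P ⊃ R) (A ∷ B ∷ C ∷ []))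

⇒-const : ∀ {A} B → ⊢ A → ⊢ B ⇒ A
⇒-const {A} B = mp (taut! (P ⊃ Q ⊃ P) (A ∷ B ∷ []))

∧-projˡ : ∀ A B → ⊢ A ∧ᵐ B ⇒ A
∧-projˡ A B = taut! (P ∧ₚ Q ⊃ P) (A ∷ B ∷ [])

∧-projʳ : ∀ A B → ⊢ A ∧ᵐ B ⇒ B
∧-projʳ A B = taut! (P ∧ₚ Q ⊃ Q) (A ∷ B ∷ [])

⇒-∧ : ∀ {C A B} → ⊢ C ⇒ A → ⊢ C ⇒ B → ⊢ C ⇒ A ∧ᵐ B
⇒-∧ {C} {A} {B} = mp₂ (taut! ((P ⊃ Q) ⊃ (P ⊃ R) ⊃ P ⊃ Q ∧ₚ R) (C ∷ A ∷ B ∷ []))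

∧-map : ∀ {A B C D} → ⊢ A ⇒ C → ⊢ B ⇒ D → ⊢ A ∧ᵐ B ⇒ C ∧ᵐ D
∧-map {A} {B} d e = ⇒-∧ (⇒-trans (∧-projˡ A B) d) (⇒-trans (∧-projʳ A B) e)

⇒-curry : ∀ {A B C} → ⊢ A ∧ᵐ B ⇒ C → ⊢ A ⇒ B ⇒ C
⇒-curry {A} {B} {C} = mp (taut! ((P ∧ₚ Q ⊃ R) ⊃ P ⊃ Q ⊃ R) (A ∷ B ∷ C ∷ []))

⇒-uncurry : ∀ {A B C} → ⊢ A ⇒ B ⇒ C → ⊢ A ∧ᵐ B ⇒ C
⇒-uncurry {A} {B} {C} = mp (taut! ((P ⊃ Q ⊃ R) ⊃ P ∧ₚ Q ⊃ R) (A ∷ B ∷ C ∷ []))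

~~-intro : ∀ A → ⊢ A ⇒ ~ ~ A
~~-intro A = taut! (P ⊃ ¬ₚ ¬ₚ P) (A ∷ [])

~~-elim : ∀ A → ⊢ ~ ~ A ⇒ A
~~-elim A = taut! (¬ₚ ¬ₚ P ⊃ P) (A ∷ [])

⇒-contrapose : ∀ {A B} → ⊢ A ⇒ B → ⊢ ~ B ⇒ ~ A
⇒-contrapose {A} {B} = mp (taut! ((P ⊃ Q) ⊃ ¬ₚ Q ⊃ ¬ₚ P) (A ∷ B ∷ []))

⇒~-swap : ∀ {A B} → ⊢ A ⇒ ~ B → ⊢ B ⇒ ~ A
⇒~-swap {A} {B} = mp (taut! ((P ⊃ ¬ₚ Q) ⊃ Q ⊃ ¬ₚ P) (A ∷ B ∷ []))

~⇒-swap : ∀ {A B} → ⊢ ~ A ⇒ B → ⊢ ~ B ⇒ A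
~⇒-swap {A} {B} = mp (taut! ((¬ₚ P ⊃ Q) ⊃ ¬ₚ Q ⊃ P) (A ∷ B ∷ []))

~-explode : ∀ {A} B → ⊢ ~ A → ⊢ A ⇒ B
~-explode {A} B = mp (taut! (¬ₚ P ⊃ P ⊃ Q) (A ∷ B ∷ []))

⊥ᵐ-elim : ∀ A → ⊢ ⊥ᵐ ⇒ A
⊥ᵐ-elim A = taut! (P ∧ₚ ¬ₚ P ⊃ Q) (T x ∷ A ∷ [])

∨-introˡ : ∀ A B → ⊢ A ⇒ A ∨ᵐ B
∨-introˡ A B = taut! (P ⊃ P ∨ₚ Q) (A ∷ B ∷ [])

∨-introʳ : ∀ A B → ⊢ B ⇒ A ∨ᵐ B
∨-introʳ A B = taut! (Q ⊃ P ∨ₚ Q) (A ∷ B ∷ [])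

∨-elim : ∀ {A B C} → ⊢ A ⇒ C → ⊢ B ⇒ C → ⊢ A ∨ᵐ B ⇒ C
∨-elim {A} {B} {C} = mp₂ (taut! ((P ⊃ R) ⊃ (Q ⊃ R) ⊃ P ∨ₚ Q ⊃ R) (A ∷ B ∷ C ∷ []))

⇔-intro : ∀ {A B} → ⊢ A ⇒ B → ⊢ B ⇒ A → ⊢ A ⇔ᵐ B
⇔-intro {A} {B} = mp₂ (taut! ((P ⊃ Q) ⊃ (Q ⊃ P) ⊃ (P ⊃ Q) ∧ₚ (Q ⊃ P)) (A ∷ B ∷ []))

⋁ : ∀ {n} → (Fin n → Fm) → Fm
⋁ = foldr _∨ᵐ_ ⊥ᵐ

⋁-intro : ∀ {n} (f : Fin n → Fm) i → ⊢ f i ⇒ ⋁ f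
⋁-intro f zero    = ∨-introˡ (f zero) _
⋁-intro f (suc i) = ⇒-trans (⋁-intro (f ∘ suc) i) (∨-introʳ (f zero) _)

⋁-elim : ∀ {n} (f : Fin n → Fm) {A} → (∀ i → ⊢ f i ⇒ A) → ⊢ ⋁ f ⇒ A
⋁-elim {zero}  f {A} _ = ⊥ᵐ-elim A
⋁-elim {suc n} f     h = ∨-elim (h zero) (⋁-elim (f ∘ suc) (h ∘ suc))

⋁-cong : ∀ {n} {f g : Fin n → Fm} → f ≗ g → ⋁ f ≡ ⋁ g
⋁-cong {zero}  _   = refl
⋁-cong {suc n} f≗g = cong₂ _∨ᵐ_ (f≗g zero) (⋁-cong (f≗g ∘ suc))

⋁-onlyVar : ∀ {n} (f : Fin n → Fm) → (∀ i → OnlyVar x (f i)) → OnlyVar x (⋁ f)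
⋁-onlyVar {zero}  f _ = refl , refl
⋁-onlyVar {suc n} f h = h zero , ⋁-onlyVar (f ∘ suc) (h ∘ suc)

□-mono : ∀ {A B} → ⊢ A ⇒ B → ⊢ □ A ⇒ □ B
□-mono = mp (ax-K _ _) ∘ nec

□-mono₂ : ∀ {A B C} → ⊢ A ∧ᵐ B ⇒ C → ⊢ □ A ∧ᵐ □ B ⇒ □ C
□-mono₂ d = ⇒-uncurry (⇒-trans (□-mono (⇒-curry d)) (ax-K _ _))

◇□⇒□ : ∀ A → ⊢ ◇ □ A ⇒ □ A
◇□⇒□ A = ~⇒-swap (⇒-trans ~□⇒◇~ (⇒-trans (ax-5 (~ A)) (□-mono ◇~⇒~□)))
  where
  ~□⇒◇~ : ⊢ ~ □ A ⇒ ◇ ~ A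
  ~□⇒◇~ = ⇒-contrapose (□-mono (~~-elim A))
  ◇~⇒~□ : ⊢ ◇ ~ A ⇒ ~ □ A
  ◇~⇒~□ = ⇒-contrapose (□-mono (~~-intro A))

□-4 : ∀ A → ⊢ □ A ⇒ □ □ A
□-4 A = ⇒-trans (⇒~-swap (ax-T (~ □ A))) (⇒-trans (ax-5 (□ A)) (□-mono (◇□⇒□ A)))

◇-□-∧ : ∀ A B → ⊢ ◇ A ∧ᵐ □ B ⇒ ◇ (A ∧ᵐ B)
◇-□-∧ A B = mp (taut! ((P ∧ₚ Q ⊃ R) ⊃ ¬ₚ R ∧ₚ Q ⊃ ¬ₚ P) (□ ~ (A ∧ᵐ B) ∷ □ B ∷ □ ~ A ∷ []))
               (□-mono₂ (taut! (¬ₚ (P ∧ₚ Q) ∧ₚ Q ⊃ ¬ₚ P) (A ∷ B ∷ [])))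

Stable : Fm → Set
Stable A = ⊢ A ⇒ □ A

∧-stable : ∀ {A B} → Stable A → Stable B → Stable (A ∧ᵐ B)
∧-stable a b = ⇒-trans (∧-map a b) (□-mono₂ (⇒-refl _))

-- Semantics

data Val : Set where
  vT vF vN : Val

isT isF isN : Val → Bool
isT vT = true
isT _  = false
isF vF = true
isF _  = false
isN vN = true
isN _  = false

data Cluster : Set where
  [t] [f] [n] [tn] [fn] [tfn] : Cluster

mem : Cluster → Val → Bool
mem [t]   = isT
mem [f]   = isF
mem [n]   = isN
mem [tn]  = not ∘ isF
mem [fn]  = not ∘ isT
mem [tfn] = λ _ → true

infixr 6 _→ᵇ_

_→ᵇ_ : Bool → Bool → Bool
a →ᵇ b = not (a ∧ not b)

everyᵛ : (Val → Bool) → Bool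
everyᵛ g = g vT ∧ g vF ∧ g vN

-- Every variable is read as x: this is still a model of the logic, which is all soundness needs.
ev : Cluster → Val → Fm → Bool
ev S v (T _)    = isT v
ev S v (F _)    = isF v
ev S v (~ A)    = not (ev S v A)
ev S v (A ∧ᵐ B) = ev S v A ∧ ev S v B
ev S v (□ A)    = everyᵛ (λ u → mem S u →ᵇ ev S u A)

→ᵇ-intro : ∀ {a b} → (a ≡ true → b ≡ true) → (a →ᵇ b) ≡ true
→ᵇ-intro {false}        _ = refl
→ᵇ-intro {true} {true}  _ = refl
→ᵇ-intro {true} {false} h = h refl

→ᵇ-elim : ∀ {a b} → (a →ᵇ b) ≡ true → a ≡ true → b ≡ true
→ᵇ-elim {true} {true} _ _ = refl

→ᵇ-antisym : ∀ {a b} → ((a →ᵇ b) ∧ (b →ᵇ a)) ≡ true → a ≡ b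
→ᵇ-antisym {false} {false} _ = refl
→ᵇ-antisym {true}  {true}  _ = refl

everyᵛ-intro : ∀ g → (∀ u → g u ≡ true) → everyᵛ g ≡ true
everyᵛ-intro g h rewrite h vT | h vF | h vN = refl

everyᵛ-elim : ∀ g → everyᵛ g ≡ true → ∀ u → g u ≡ true
everyᵛ-elim g h vT = ∧-conicalˡ (g vT) _ h
everyᵛ-elim g h vF = ∧-conicalˡ (g vF) _ (∧-conicalʳ (g vT) _ h)
everyᵛ-elim g h vN = ∧-conicalʳ (g vF) _ (∧-conicalʳ (g vT) _ h)

ev-subst : ∀ S v σ p → ev S v (subst σ p) ≡ evalP (λ n → ev S v (σ n)) p
ev-subst S v σ (atom n)   = refl
ev-subst S v σ (pnot p)   = cong not (ev-subst S v σ p)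
ev-subst S v σ (pand p q) = cong₂ _∧_ (ev-subst S v σ p) (ev-subst S v σ q)

con-valid : ∀ S v y → ev S v (~ (T y ∧ᵐ F y)) ≡ true
con-valid S vT y = refl
con-valid S vF y = refl
con-valid S vN y = refl

ground-valid : ∀ S v y → ev S v ((◇ T y ∧ᵐ ◇ F y) ⇒ ◇ N y) ≡ true
ground-valid [t]   v y = refl
ground-valid [f]   v y = refl
ground-valid [n]   v y = refl
ground-valid [tn]  v y = refl
ground-valid [fn]  v y = refl
ground-valid [tfn] v y = refl

module _ (S : Cluster) where

  ev-⇒-intro : ∀ v A B → (ev S v A ≡ true → ev S v B ≡ true) → ev S v (A ⇒ B) ≡ true
  ev-⇒-intro v A B = →ᵇ-intro

  ev-⇒-elim : ∀ v A B → ev S v (A ⇒ B) ≡ true → ev S v A ≡ true → ev S v B ≡ true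
  ev-⇒-elim v A B = →ᵇ-elim

  ev-□-intro : ∀ v A → (∀ {u} → mem S u ≡ true → ev S u A ≡ true) → ev S v (□ A) ≡ true
  ev-□-intro v A h = everyᵛ-intro (λ u → mem S u →ᵇ ev S u A) λ _ → →ᵇ-intro h

  ev-□-elim : ∀ v {u} A → ev S v (□ A) ≡ true → mem S u ≡ true → ev S u A ≡ true
  ev-□-elim v {u} A h = →ᵇ-elim (everyᵛ-elim (λ u → mem S u →ᵇ ev S u A) h u)

  sound : ∀ {A} → ⊢ A → ∀ v → mem S v ≡ true → ev S v A ≡ true
  sound (taut p τ σ)     v _   = trans (ev-subst S v σ p) (τ _)
  sound (ax-K A B)       v _   =
    ev-⇒-intro v (□ (A ⇒ B)) (□ A ⇒ □ B) λ □A⇒B → ev-⇒-intro v (□ A) (□ B) λ □A →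
    ev-□-intro v B λ {u} u∈S →
    ev-⇒-elim u A B (ev-□-elim v (A ⇒ B) □A⇒B u∈S) (ev-□-elim v A □A u∈S)
  sound (ax-T A)         v v∈S = ev-⇒-intro v (□ A) A λ □A → ev-□-elim v A □A v∈S
  sound (ax-5 A)         v _   = ev-⇒-intro v (◇ A) (□ ◇ A) λ ◇A → ev-□-intro v (◇ A) λ _ → ◇A
  sound (con y)          v _   = con-valid S v y
  sound (ground y)       v _   = ground-valid S v y
  sound (mp {A} {B} d e) v v∈S = ev-⇒-elim v A B (sound d v v∈S) (sound e v v∈S)
  sound (nec {A} d)      v _   = ev-□-intro v A λ {u} u∈S → sound d u u∈S

  sound-≈ : ∀ {A B} → A ≈ B → ∀ v → mem S v ≡ true → ev S v A ≡ ev S v B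
  sound-≈ A≈B v v∈S = →ᵇ-antisym (sound A≈B v v∈S)

ev-⊥ᵐ : ∀ S v → ev S v ⊥ᵐ ≢ true
ev-⊥ᵐ S vT ()
ev-⊥ᵐ S vF ()
ev-⊥ᵐ S vN ()

module _ (S : Cluster) (v : Val) where

  ev-⋁-intro : ∀ {n} (f : Fin n → Fm) i → ev S v (f i) ≡ true → ev S v (⋁ f) ≡ true
  ev-⋁-intro f zero    h rewrite h = refl
  ev-⋁-intro f (suc i) h rewrite ev-⋁-intro (f ∘ suc) i h = cong not (∧-zeroʳ _)

  ev-⋁-elim : ∀ {n} (f : Fin n → Fm) → ev S v (⋁ f) ≡ true → ∃ λ i → ev S v (f i) ≡ true
  ev-⋁-elim {zero}  f h = ⊥-elim (ev-⊥ᵐ S v h)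
  ev-⋁-elim {suc n} f h with ev S v (f zero) in f₀
  ... | true  = zero , f₀
  ... | false =
    let i , fᵢ = ev-⋁-elim (f ∘ suc) (trans (sym (not-involutive _)) h) in suc i , fᵢ

-- Characteristic formulas and the truth lemma

val : Val → Fm
val vT = T x
val vF = F x
val vN = N x

presence : Bool → Val → Fm
presence true  u = ◇ val u
presence false u = □ ~ val u

description : Cluster → Fm
description S = presence (mem S vT) vT ∧ᵐ presence (mem S vF) vF ∧ᵐ presence (mem S vN) vN

χ : Cluster → Val → Fm
χ S v = val v ∧ᵐ description S

val-onlyVar : ∀ v → OnlyVar x (val v)
val-onlyVar vT = refl
val-onlyVar vF = refl
val-onlyVar vN = refl , refl

presence-onlyVar : ∀ b u → OnlyVar x (presence b u)
presence-onlyVar true  u = val-onlyVar u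
presence-onlyVar false u = val-onlyVar u

χ-onlyVar : ∀ S v → OnlyVar x (χ S v)
χ-onlyVar S v = val-onlyVar v , presence-onlyVar (mem S vT) vT
                              , presence-onlyVar (mem S vF) vF
                              , presence-onlyVar (mem S vN) vN

description⇒presence : ∀ S u {b} → mem S u ≡ b → ⊢ description S ⇒ presence b u
description⇒presence S vT refl = ∧-projˡ _ _
description⇒presence S vF refl = ⇒-trans (∧-projʳ _ _) (∧-projˡ _ _)
description⇒presence S vN refl = ⇒-trans (∧-projʳ _ _) (∧-projʳ _ _)

presence-stable : ∀ b u → Stable (presence b u)
presence-stable true  u = ax-5 (val u)
presence-stable false u = □-4 (~ val u)

description-stable : ∀ S → Stable (description S)
description-stable S =
  ∧-stable (presence-stable _ vT) (∧-stable (presence-stable _ vF) (presence-stable _ vN))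

χ⇒description : ∀ S v → ⊢ χ S v ⇒ description S
χ⇒description S v = ∧-projʳ (val v) (description S)

χ⇒◇χ : ∀ {S u} v → mem S u ≡ true → ⊢ χ S v ⇒ ◇ χ S u
χ⇒◇χ {S} {u} v u∈S =
  ⇒-trans (χ⇒description S v)
          (⇒-trans (⇒-∧ (description⇒presence S u u∈S) (description-stable S))
                   (◇-□-∧ (val u) (description S)))

χ-inconsistent : ∀ {S u} → mem S u ≡ false → ⊢ ~ χ S u
χ-inconsistent {S} {u} u∉S =
  mp (taut! ((Q ⊃ ¬ₚ P) ⊃ ¬ₚ (P ∧ₚ Q)) (val u ∷ description S ∷ []))
     (⇒-trans (description⇒presence S u u∉S) (ax-T (~ val u)))

⋁χ : Cluster → Fm
⋁χ S = χ S vT ∨ᵐ χ S vF ∨ᵐ χ S vN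

χ⇒□⋁χ : ∀ S v → ⊢ χ S v ⇒ □ ⋁χ S
χ⇒□⋁χ S v =
  ⇒-trans (χ⇒description S v)
          (⇒-trans (⇒-∧ (description-stable S) (⇒-const (description S) (nec someValue)))
                   (□-mono₂ distribute))
  where
  someValue : ⊢ val vT ∨ᵐ val vF ∨ᵐ val vN
  someValue = taut! (P ∨ₚ Q ∨ₚ ¬ₚ P ∧ₚ ¬ₚ Q) (T x ∷ F x ∷ [])
  distribute : ⊢ description S ∧ᵐ (val vT ∨ᵐ val vF ∨ᵐ val vN) ⇒ ⋁χ S
  distribute = taut! (P ∧ₚ (Q ∨ₚ R ∨ₚ U) ⊃ Q ∧ₚ P ∨ₚ R ∧ₚ P ∨ₚ U ∧ₚ P)
                     (description S ∷ val vT ∷ val vF ∷ val vN ∷ [])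

lit : Bool → Fm → Fm
lit true  A = A
lit false A = ~ A

lit-~ : ∀ {C A} b → ⊢ C ⇒ lit b A → ⊢ C ⇒ lit (not b) (~ A)
lit-~ {A = A} true  d = ⇒-trans d (~~-intro A)
lit-~         false d = d

lit-∧ : ∀ {C A B} a b → ⊢ C ⇒ lit a A → ⊢ C ⇒ lit b B → ⊢ C ⇒ lit (a ∧ b) (A ∧ᵐ B)
lit-∧             true  true  d e = ⇒-∧ d e
lit-∧ {A = A} {B} true  false d e = ⇒-trans e (taut! (¬ₚ Q ⊃ ¬ₚ (P ∧ₚ Q)) (A ∷ B ∷ []))
lit-∧ {A = A} {B} false _     d e = ⇒-trans d (taut! (¬ₚ P ⊃ ¬ₚ (P ∧ₚ Q)) (A ∷ B ∷ []))

val-decides-T : ∀ v → ⊢ val v ⇒ lit (isT v) (T x)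
val-decides-T vT = ⇒-refl (T x)
val-decides-T vF = mp (taut! (¬ₚ (P ∧ₚ Q) ⊃ Q ⊃ ¬ₚ P) (T x ∷ F x ∷ [])) (con x)
val-decides-T vN = ∧-projˡ _ _

val-decides-F : ∀ v → ⊢ val v ⇒ lit (isF v) (F x)
val-decides-F vT = mp (taut! (¬ₚ (P ∧ₚ Q) ⊃ P ⊃ ¬ₚ Q) (T x ∷ F x ∷ [])) (con x)
val-decides-F vF = ⇒-refl (F x)
val-decides-F vN = ∧-projʳ _ _

module _ (S : Cluster) (A : Fm) (ih : ∀ {u b} → ev S u A ≡ b → ⊢ χ S u ⇒ lit b A) where

  admits : Val → Bool
  admits u = mem S u →ᵇ ev S u A

  χ⇒A : ∀ u → admits u ≡ true → ⊢ χ S u ⇒ A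
  χ⇒A u ok with mem S u in memᵤ | ev S u A in Aᵤ
  χ⇒A u _  | true  | true  = ih Aᵤ
  χ⇒A u () | true  | false
  χ⇒A u _  | false | _     = ~-explode A (χ-inconsistent {S} memᵤ)

  χ⇒~□A : ∀ u v → admits u ≡ false → ⊢ χ S v ⇒ ~ □ A
  χ⇒~□A u v nok with mem S u in memᵤ | ev S u A in Aᵤ
  χ⇒~□A u v _  | true  | false = ⇒-trans (χ⇒◇χ {S} v memᵤ) (⇒-contrapose (□-mono (⇒~-swap (ih Aᵤ))))
  χ⇒~□A u v () | true  | true
  χ⇒~□A u v () | false | _

  χ-decides-□ : ∀ v → ⊢ χ S v ⇒ lit (ev S v (□ A)) (□ A)
  χ-decides-□ v with admits vT in okT | admits vF in okF | admits vN in okN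
  ... | true  | true  | true  =
    ⇒-trans (χ⇒□⋁χ S v) (□-mono (∨-elim (χ⇒A vT okT) (∨-elim (χ⇒A vF okF) (χ⇒A vN okN))))
  ... | false | _     | _     = χ⇒~□A vT v okT
  ... | true  | false | _     = χ⇒~□A vF v okF
  ... | true  | true  | false = χ⇒~□A vN v okN

χ-decides : ∀ φ → OnlyVar x φ → ∀ S v → ⊢ χ S v ⇒ lit (ev S v φ) φ
χ-decides (T _)    refl        S v = ⇒-trans (∧-projˡ (val v) (description S)) (val-decides-T v)
χ-decides (F _)    refl        S v = ⇒-trans (∧-projˡ (val v) (description S)) (val-decides-F v)
χ-decides (~ A)    A-x         S v = lit-~ (ev S v A) (χ-decides A A-x S v)
χ-decides (A ∧ᵐ B) (A-x , B-x) S v =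
  lit-∧ (ev S v A) (ev S v B) (χ-decides A A-x S v) (χ-decides B B-x S v)
χ-decides (□ A)    A-x         S v = χ-decides-□ S A (λ { {u} refl → χ-decides A A-x S u }) v

-- The ten points and normal forms

record Point : Set where
  constructor point⟨_,_⟩
  field
    cluster  : Cluster
    value    : Val
    {occurs} : IsTrue (mem cluster value)

open Point

point : Fin 10 → Point
point 0F = point⟨ [t]   , vT ⟩
point 1F = point⟨ [f]   , vF ⟩
point 2F = point⟨ [n]   , vN ⟩
point 3F = point⟨ [tn]  , vT ⟩
point 4F = point⟨ [tn]  , vN ⟩
point 5F = point⟨ [fn]  , vF ⟩
point 6F = point⟨ [fn]  , vN ⟩
point 7F = point⟨ [tfn] , vT ⟩
point 8F = point⟨ [tfn] , vF ⟩
point 9F = point⟨ [tfn] , vN ⟩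

χᴾ : Point → Fm
χᴾ p = χ (cluster p) (value p)

evᴾ : Point → Fm → Bool
evᴾ p = ev (cluster p) (value p)

-- The skeletons below mirror val, presence and χ over the five formulas in basic, so that
-- exhaustiveness is one tautology instance, from Ground and the T axioms for ¬T x, ¬F x, ¬N x.
exhaustive : ⊢ ⋁ (χᴾ ∘ point)
exhaustive =
  mp₂ (mp₂ (taut! (groundₚ ⊃ reflexₚ vT ⊃ reflexₚ vF ⊃ reflexₚ vN ⊃ ⋁ₚ (χₚ ∘ point)) basic)
           (ground x) (ax-T (~ T x)))
      (ax-T (~ F x)) (ax-T (~ N x))
  where
  basic : List Fm
  basic = T x ∷ F x ∷ □ ~ T x ∷ □ ~ F x ∷ □ ~ N x ∷ []
  valₚ □~valₚ : Val → PFm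
  valₚ vT = atom 0
  valₚ vF = atom 1
  valₚ vN = ¬ₚ atom 0 ∧ₚ ¬ₚ atom 1
  □~valₚ vT = atom 2
  □~valₚ vF = atom 3
  □~valₚ vN = atom 4
  presenceₚ : Bool → Val → PFm
  presenceₚ true  u = ¬ₚ □~valₚ u
  presenceₚ false u = □~valₚ u
  χₚ : Point → PFm
  χₚ point⟨ S , v ⟩ =
    valₚ v ∧ₚ presenceₚ (mem S vT) vT ∧ₚ presenceₚ (mem S vF) vF ∧ₚ presenceₚ (mem S vN) vN
  groundₚ : PFm
  groundₚ = ¬ₚ □~valₚ vT ∧ₚ ¬ₚ □~valₚ vF ⊃ ¬ₚ □~valₚ vN
  reflexₚ : Val → PFm
  reflexₚ u = □~valₚ u ⊃ ¬ₚ valₚ u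
  ⋁ₚ : ∀ {n} → (Fin n → PFm) → PFm
  ⋁ₚ = foldr _∨ₚ_ (P ∧ₚ ¬ₚ P)

χ-holds : ∀ i → evᴾ (point i) (χᴾ (point i)) ≡ true
χ-holds = toWitness {a? = all? λ i → evᴾ (point i) (χᴾ (point i)) Bool.≟ true} _

χ-separates : ∀ i j → evᴾ (point i) (χᴾ (point j)) ≡ true → i ≡ j
χ-separates =
  toWitness {a? = all? λ i → all? λ j → (evᴾ (point i) (χᴾ (point j)) Bool.≟ true) →-dec (i ≟ j)} _

table : Fm → Fin 10 → Bool
table φ i = evᴾ (point i) φ

table-respects-≈ : ∀ {φ ψ} → φ ≈ ψ → table φ ≗ table ψ
table-respects-≈ φ≈ψ i = sound-≈ (cluster p) φ≈ψ (value p) (Equivalence.to T-≡ (occurs p))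
  where p = point i

keepIf : Bool → Fm → Fm
keepIf true  A = A
keepIf false _ = ⊥ᵐ

disjunct : (Fin 10 → Bool) → Fin 10 → Fm
disjunct t i = keepIf (t i) (χᴾ (point i))

normalForm : (Fin 10 → Bool) → Fm
normalForm t = ⋁ (disjunct t)

normalForm-cong : ∀ {t u} → t ≗ u → normalForm t ≡ normalForm u
normalForm-cong t≗u = ⋁-cong λ i → cong (λ b → keepIf b (χᴾ (point i))) (t≗u i)

normalForm-onlyVar : ∀ t → OnlyVar x (normalForm t)
normalForm-onlyVar t =
  ⋁-onlyVar (disjunct t) λ i →
    keepIf-onlyVar (t i) (χ-onlyVar (cluster (point i)) (value (point i)))
  where
  keepIf-onlyVar : ∀ {A} b → OnlyVar x A → OnlyVar x (keepIf b A)
  keepIf-onlyVar true  A-x = A-x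
  keepIf-onlyVar false _   = refl , refl

normalForm-true⇒ : ∀ t i → table (normalForm t) i ≡ true → t i ≡ true
normalForm-true⇒ t i h with ev-⋁-elim _ _ (disjunct t) h
... | j , disjunctⱼ with t j in tⱼ
...   | false = ⊥-elim (ev-⊥ᵐ (cluster (point i)) (value (point i)) disjunctⱼ)
...   | true rewrite χ-separates i j disjunctⱼ = tⱼ

⇒normalForm-true : ∀ t i → t i ≡ true → table (normalForm t) i ≡ true
⇒normalForm-true t i tᵢ = ev-⋁-intro _ _ (disjunct t) i
  (≡-subst (λ b → evᴾ (point i) (keepIf b (χᴾ (point i))) ≡ true) (sym tᵢ) (χ-holds i))

table-normalForm : ∀ t → table (normalForm t) ≗ t
table-normalForm t i with t i in tᵢ
... | true  = ⇒normalForm-true t i tᵢ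
... | false = ¬-not λ h → case trans (sym (normalForm-true⇒ t i h)) tᵢ of λ ()

keepIf-⇒ : ∀ {C A} b → ⊢ C ⇒ lit b A → ⊢ keepIf b C ⇒ A
keepIf-⇒         true  d = d
keepIf-⇒ {A = A} false _ = ⊥ᵐ-elim A

⇒-keepIf : ∀ {C A} b → ⊢ C ⇒ lit b A → ⊢ C ∧ᵐ A ⇒ keepIf b C
⇒-keepIf {C} {A} true  _ = ∧-projˡ C A
⇒-keepIf {C} {A} false d = mp (taut! ((P ⊃ ¬ₚ Q) ⊃ P ∧ₚ Q ⊃ R) (C ∷ A ∷ ⊥ᵐ ∷ [])) d

normalForm-complete : ∀ φ → OnlyVar x φ → φ ≈ normalForm (table φ)
normalForm-complete φ φ-x = ⇔-intro (mp (⋁-elim (χᴾ ∘ point) χ⇒φ⇒nf) exhaustive)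
                                    (⋁-elim (disjunct (table φ)) (λ i → keepIf-⇒ _ (decides i)))
  where
  decides : ∀ i → ⊢ χᴾ (point i) ⇒ lit (table φ i) φ
  decides i = χ-decides φ φ-x (cluster (point i)) (value (point i))
  χ⇒φ⇒nf : ∀ i → ⊢ χᴾ (point i) ⇒ φ ⇒ normalForm (table φ)
  χ⇒φ⇒nf i = ⇒-curry (⇒-trans (⇒-keepIf _ (decides i)) (⋁-intro (disjunct (table φ)) i))

-- Counting truth tables

funToFin-cong : ∀ {m n} {f g : Fin m → Fin n} → f ≗ g → funToFin f ≡ funToFin g
funToFin-cong {zero}  _   = refl
funToFin-cong {suc m} f≗g = cong₂ combine (f≗g zero) (funToFin-cong (f≗g ∘ suc))

module _ {n : ℕ} where
  open Inverse 2↔Bool using (to; from; strictlyInverseˡ; strictlyInverseʳ)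

  tableIndex : (Fin n → Bool) → Fin (2 ^ n)
  tableIndex t = funToFin (from ∘ t)

  indexTable : Fin (2 ^ n) → Fin n → Bool
  indexTable k = to ∘ finToFun k

  indexTable-tableIndex : ∀ t → indexTable (tableIndex t) ≗ t
  indexTable-tableIndex t i =
    trans (cong to (finToFun-funToFin (from ∘ t) i)) (strictlyInverseˡ (t i))

  tableIndex-indexTable : ∀ k → tableIndex (indexTable k) ≡ k
  tableIndex-indexTable k =
    trans (funToFin-cong {n} (strictlyInverseʳ ∘ finToFun k)) (funToFin-finToFin {n} k)

  tableIndex-cong : ∀ {t u} → t ≗ u → tableIndex t ≡ tableIndex u
  tableIndex-cong t≗u = funToFin-cong (cong from ∘ t≗u)

exactlyNClasses-viaTables :
  ∀ {n} (table : Fm → Fin n → Bool) (nf : (Fin n → Bool) → Fm) →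
  (∀ t → OnlyVar x (nf t)) →
  (∀ {t u} → t ≗ u → nf t ≡ nf u) →
  (∀ t → table (nf t) ≗ t) →
  (∀ {φ ψ} → φ ≈ ψ → table φ ≗ table ψ) →
  (∀ φ → OnlyVar x φ → φ ≈ nf (table φ)) →
  ExactlyNClasses (2 ^ n)
exactlyNClasses-viaTables {n} table nf nf-x nf-cong table-nf table-≈ complete =
  nf ∘ indexTable , nf-x ∘ indexTable , injective , covering
  where
  injective : ∀ k l → nf (indexTable k) ≈ nf (indexTable l) → k ≡ l
  injective k l eq = begin
    k                             ≡⟨ tableIndex-indexTable {n} k ⟨
    tableIndex (indexTable {n} k) ≡⟨ tableIndex-cong same-table ⟩
    tableIndex (indexTable {n} l) ≡⟨ tableIndex-indexTable {n} l ⟩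
    l                             ∎
    where
    open ≡-Reasoning
    same-table : indexTable k ≗ indexTable l
    same-table i = trans (sym (table-nf _ i)) (trans (table-≈ eq i) (table-nf _ i))
  covering : ∀ φ → OnlyVar x φ → ∃ λ k → φ ≈ nf (indexTable k)
  covering φ φ-x = tableIndex (table φ) ,
    ≡-subst (φ ≈_) (nf-cong (sym ∘ indexTable-tableIndex (table φ))) (complete φ φ-x)

mainTheorem6 : ExactlyNClasses 1024
mainTheorem6 = exactlyNClasses-viaTables table normalForm
  normalForm-onlyVar normalForm-cong table-normalForm table-respects-≈ normalForm-complete
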